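{- Let $x=\langle d,k,m\rangle\in M_n\setminus\{\mathbf{0}\}$ and $j\in\mathbb{N}$. Define $$d^{(j)}=jd,\qquad k^{(j)}=k-(j-1)\min(0,d),\qquad m^{(j)}=m-(j-1)\max(0,d).$$ Then $x^j=\langle d^{(j)},k^{(j)},m^{(j)}\rangle$ if $k^{(j)}\le m^{(j)}$, and $x^j=\mathbf{0}$ if $k^{(j)}>m^{(j)}$. Furthermore, whenever $x^j\ne\mathbf{0}$, the number of ones in the matrix $x^j$ equals $m-k+1-(j-1)|d|$.
   Context: Fix an integer $n\ge 2$. For integers $d,k,m$ with $1-\min(0,d)\le k\le m\le n-\max(0,d)$, let $\langle d,k,m\rangle$ denote the $n\times n$ matrix with entries $x_{ij}$ ($i,j\in\{1,\dots,n\}$) equal to $1$ if $k\le i\le m$ and $j-i=d$, and $0$ otherwise. Let $\mathbf{0}$ be the $n\times n$ zero matrix and $M_n=\{\mathbf{0}\}\cup\{\langle d,k,m\rangle: d\in\mathbb{Z},\ k,m\in\mathbb{N},\ 1-\min(0,d)\le k\le m\le n-\max(0,d)\}$, a monoid under matrix multiplication. -}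

module Defs where

open import Data.Nat as ℕ using (ℕ; zero; suc)
open import Data.Integer as ℤ using (ℤ; +_; _⊓_; _⊔_; ∣_∣; _≤?_; _≟_)
open import Data.Fin using (Fin; toℕ)
open import Data.Bool using (Bool; if_then_else_; _∧_)
open import Relation.Nullary.Decidable using (⌊_⌋)
open import Relation.Binary.PropositionalEquality using (_≡_)
open import Data.Product using (_×_)

-- n×n matrices with natural-number entries, rows/columns indexed by Fin n
-- (Fin index i corresponds to the paper's row/column number toℕ i + 1).
Mat : ℕ → Set
Mat n = Fin n → Fin n → ℕ

sumFin : ∀ {n} → (Fin n → ℕ) → ℕ
sumFin {zero}  f = 0
sumFin {suc n} f = f Fin.zero ℕ.+ sumFin (λ i → f (Fin.suc i))
  where import Data.Fin as Fin

_⊗_ : ∀ {n} → Mat n → Mat n → Mat n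
(A ⊗ B) i j = sumFin (λ l → A i l ℕ.* B l j)

identity : ∀ {n} → Mat n
identity i j = if ⌊ toℕ i ℕ.≟ toℕ j ⌋ then 1 else 0

_^_ : ∀ {n} → Mat n → ℕ → Mat n
x ^ zero  = identity
x ^ suc j = x ⊗ (x ^ j)

zeroMat : ∀ {n} → Mat n
zeroMat i j = 0

_≈_ : ∀ {n} → Mat n → Mat n → Set
A ≈ B = ∀ i j → A i j ≡ B i j

idx : ∀ {n} → Fin n → ℤ
idx i = + suc (toℕ i)

⟨_,_,_⟩ : ∀ {n} → ℤ → ℤ → ℤ → Mat n
⟨ d , k , m ⟩ i j =
  if ⌊ k ≤? idx i ⌋ ∧ ⌊ idx i ≤? m ⌋ ∧ ⌊ idx j ℤ.- idx i ≟ d ⌋ then 1 else 0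

-- side condition 1 - min(0,d) ≤ k ≤ m ≤ n - max(0,d) for ⟨d,k,m⟩ ∈ M_n
Valid : ℕ → ℤ → ℤ → ℤ → Set
Valid n d k m =
  (+ 1 ℤ.- (+ 0 ⊓ d) ℤ.≤ k) × (k ℤ.≤ m) × (m ℤ.≤ + n ℤ.- (+ 0 ⊔ d))

countOnes : ∀ {n} → Mat n → ℕ
countOnes A = sumFin (λ i → sumFin (λ j → if ⌊ A i j ℕ.≟ 1 ⌋ then 1 else 0))

dPow : ℕ → ℤ → ℤ
dPow j d = + j ℤ.* d

kPow : ℕ → ℤ → ℤ → ℤ
kPow j d k = k ℤ.- (+ j ℤ.- + 1) ℤ.* (+ 0 ⊓ d)

mPow : ℕ → ℤ → ℤ → ℤ
mPow j d m = m ℤ.- (+ j ℤ.- + 1) ℤ.* (+ 0 ⊔ d)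

-- Row i of ⟨d,k,m⟩ has its only possible 1 in column i + d, so the product
-- ⟨d,k,m⟩ ⟨d',k',m'⟩ is again a diagonal segment: its rows are those i ∈ [k,m]
-- with i + d ∈ [k',m'], i.e. the window [k ⊔ (k' − d), m ⊓ (m' − d)], on the
-- diagonal d + d'. Iterating, each further factor shrinks the window by |d|
-- from one end (the left end if d < 0, the right end if d > 0), and a
-- nonempty window [K,M] contributes exactly M − K + 1 ones.
module Submission where

open import Defs
open import Data.Bool using (if_then_else_)
open import Data.Nat as ℕ using (ℕ; zero; suc; z≤n; s≤s; s≤s⁻¹)
import Data.Nat.Properties as ℕ
open import Data.Integer as ℤ
  using (ℤ; +_; -[1+_]; ∣_∣; _+_; _-_; -_; _*_; _⊓_; _⊔_; _≤_; _<_; +≤+)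
import Data.Integer.Properties as ℤ
open import Data.Integer.Tactic.RingSolver using (solve-∀)
open import Data.Fin as Fin using (Fin; toℕ; fromℕ<)
import Data.Fin.Properties as Fin
open import Data.Product using (_×_; _,_; proj₁; proj₂)
open import Function using (_∘_)
open import Function.Bundles using (_⇔_; mk⇔; Equivalence)
open import Relation.Nullary using (¬_; Dec; yes; no; _×-dec_; contradiction)
open import Relation.Nullary.Decidable using (⌊_⌋)
open import Relation.Binary.PropositionalEquality

private variable
  n : ℕ

sumFin-cong : {f g : Fin n → ℕ} → (∀ i → f i ≡ g i) → sumFin f ≡ sumFin g
sumFin-cong {zero}  f≡g = refl
sumFin-cong {suc n} f≡g = cong₂ ℕ._+_ (f≡g Fin.zero) (sumFin-cong (f≡g ∘ Fin.suc))

sumFin-zero : {f : Fin n → ℕ} → (∀ i → f i ≡ 0) → sumFin f ≡ 0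
sumFin-zero {zero}  f≡0 = refl
sumFin-zero {suc n} f≡0 = cong₂ ℕ._+_ (f≡0 Fin.zero) (sumFin-zero (f≡0 ∘ Fin.suc))

sumFin-single : {f : Fin n → ℕ} (p : Fin n) → (∀ l → l ≢ p → f l ≡ 0) → sumFin f ≡ f p
sumFin-single {suc n} {f} Fin.zero f≡0 =
  trans (cong (f Fin.zero ℕ.+_) (sumFin-zero (λ i → f≡0 (Fin.suc i) λ ())))
        (ℕ.+-identityʳ _)
sumFin-single {suc n} (Fin.suc p) f≡0 =
  cong₂ ℕ._+_ (f≡0 Fin.zero λ ())
              (sumFin-single p (λ l l≢p → f≡0 (Fin.suc l) (l≢p ∘ Fin.suc-injective)))

indicator : {A : Set} → Dec A → ℕ
indicator a? = if ⌊ a? ⌋ then 1 else 0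

module _ {A : Set} where

  indicator-yes : (a? : Dec A) → A → indicator a? ≡ 1
  indicator-yes (yes _) _ = refl
  indicator-yes (no ¬a) a = contradiction a ¬a

  indicator-no : (a? : Dec A) → ¬ A → indicator a? ≡ 0
  indicator-no (yes a) ¬a = contradiction a ¬a
  indicator-no (no _)  _  = refl

  indicator-by-cases : ∀ {x} (a? : Dec A) → (A → x ≡ 1) → (¬ A → x ≡ 0) → x ≡ indicator a?
  indicator-by-cases (yes a) x≡1 _   = x≡1 a
  indicator-by-cases (no ¬a) _   x≡0 = x≡0 ¬a

module _ {A B : Set} where

  indicator-cong : (a? : Dec A) (b? : Dec B) → A ⇔ B → indicator a? ≡ indicator b?
  indicator-cong a? (yes b) A⇔B = indicator-yes a? (Equivalence.from A⇔B b)
  indicator-cong a? (no ¬b) A⇔B = indicator-no a? (¬b ∘ Equivalence.to A⇔B)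

  indicator-* : (a? : Dec A) (b? : Dec B) →
                indicator a? ℕ.* indicator b? ≡ indicator (a? ×-dec b?)
  indicator-* (yes _) (yes _) = refl
  indicator-* (yes _) (no _)  = refl
  indicator-* (no _)  _       = refl

indicator-≟1 : {A : Set} (a? : Dec A) → indicator (indicator a? ℕ.≟ 1) ≡ indicator a?
indicator-≟1 (yes _) = refl
indicator-≟1 (no _)  = refl

sumFin-indicator-at : {P : Fin n → Set} (P? : ∀ l → Dec (P l)) (l₀ : Fin n) →
                      (∀ {l} → P l → l ≡ l₀) → sumFin (indicator ∘ P?) ≡ indicator (P? l₀)
sumFin-indicator-at P? l₀ only-l₀ =
  sumFin-single l₀ (λ l l≢l₀ → indicator-no (P? l) (l≢l₀ ∘ only-l₀))

infix 4 _∈[_,_] _∈?[_,_]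

_∈[_,_] : ℤ → ℤ → ℤ → Set
x ∈[ a , b ] = a ≤ x × x ≤ b

_∈?[_,_] : ∀ x a b → Dec (x ∈[ a , b ])
x ∈?[ a , b ] = a ℤ.≤? x ×-dec x ℤ.≤? b

private
  -+-cancel : ∀ i k → i - k + k ≡ i
  -+-cancel = solve-∀

  +--cancel : ∀ i k → i + k - k ≡ i
  +--cancel = solve-∀

i-k≤j⇔i≤j+k : ∀ i j k → i - k ≤ j ⇔ i ≤ j + k
i-k≤j⇔i≤j+k i j k = mk⇔
  (λ i-k≤j → subst (_≤ j + k) (-+-cancel i k) (ℤ.+-monoˡ-≤ k i-k≤j))
  (λ i≤j+k → subst (i - k ≤_) (+--cancel j k) (ℤ.+-monoˡ-≤ (- k) i≤j+k))

i≤j-k⇔i+k≤j : ∀ i j k → i ≤ j - k ⇔ i + k ≤ j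
i≤j-k⇔i+k≤j i j k = mk⇔
  (λ i≤j-k → subst (i + k ≤_) (-+-cancel j k) (ℤ.+-monoˡ-≤ k i≤j-k))
  (λ i+k≤j → subst (_≤ j - k) (+--cancel i k) (ℤ.+-monoˡ-≤ (- k) i+k≤j))

∈-window⇔ : ∀ x d k m k′ m′ →
            x ∈[ k ⊔ (k′ - d) , m ⊓ (m′ - d) ] ⇔ (x ∈[ k , m ] × x + d ∈[ k′ , m′ ])
∈-window⇔ x d k m k′ m′ = mk⇔
  (λ (K≤x , x≤M) →
       (ℤ.i⊔j≤k⇒i≤k k _ K≤x , ℤ.i≤j⊓k⇒i≤j m _ x≤M)
     , ( Equivalence.to (i-k≤j⇔i≤j+k k′ x d) (ℤ.i⊔j≤k⇒j≤k k _ K≤x)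
       , Equivalence.to (i≤j-k⇔i+k≤j x m′ d) (ℤ.i≤j⊓k⇒i≤k m _ x≤M)))
  (λ ((k≤x , x≤m) , (k′≤x+d , x+d≤m′)) →
       ℤ.⊔-lub k≤x (Equivalence.from (i-k≤j⇔i≤j+k k′ x d) k′≤x+d)
     , ℤ.⊓-glb x≤m (Equivalence.from (i≤j-k⇔i+k≤j x m′ d) x+d≤m′))

diff-shift : ∀ x y {z} a b → z ≡ x + a → y - z ≡ b ⇔ y - x ≡ a + b
diff-shift x y a b refl = mk⇔
  (λ y-z≡b → trans (regroup y x a) (cong (λ t → a + t) y-z≡b))
  (λ y-x≡a+b → trans (ungroup y x a) (trans (cong (_- a) y-x≡a+b) (cancel a b)))
  where
  regroup : ∀ y x a → y - x ≡ a + (y - (x + a))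
  regroup = solve-∀
  ungroup : ∀ y x a → y - (x + a) ≡ y - x - a
  ungroup = solve-∀
  cancel : ∀ a b → a + b - a ≡ b
  cancel = solve-∀

column⇒diagonal : ∀ x {y} d → y ≡ x + d → y - x ≡ d
column⇒diagonal x d refl = cancel x d
  where
  cancel : ∀ x d → x + d - x ≡ d
  cancel = solve-∀

idx-injective : {l l′ : Fin n} → idx l ≡ idx l′ → l ≡ l′
idx-injective = Fin.toℕ-injective ∘ ℕ.suc-injective ∘ ℤ.+-injective

idx∈[1,n] : (l : Fin n) → idx l ∈[ + 1 , + n ]
idx∈[1,n] l = +≤+ (s≤s z≤n) , +≤+ (Fin.toℕ<n l)

fromIdx : ∀ x → x ∈[ + 1 , + n ] → Fin n
fromIdx (+ suc t) (_ , x≤n) = fromℕ< (ℤ.drop‿+≤+ x≤n)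
fromIdx (+ zero)  (+≤+ () , _)

idx-fromIdx : ∀ x (x∈ : x ∈[ + 1 , + n ]) → idx (fromIdx x x∈) ≡ x
idx-fromIdx (+ suc t) (_ , x≤n) = cong (+_ ∘ suc) (Fin.toℕ-fromℕ< _)
idx-fromIdx (+ zero)  (+≤+ () , _)

OnDiagonal : ℤ → ℤ → ℤ → Fin n → Fin n → Set
OnDiagonal d k m i j = idx i ∈[ k , m ] × idx j - idx i ≡ d

onDiagonal? : ∀ d k m (i j : Fin n) → Dec (OnDiagonal d k m i j)
onDiagonal? d k m i j = idx i ∈?[ k , m ] ×-dec idx j - idx i ℤ.≟ d

-- Not by refl: ⌊ a? ×-dec b? ⌋ does not reduce to ⌊ a? ⌋ ∧ ⌊ b? ⌋.
⟨⟩-entry : ∀ d k m (i j : Fin n) → ⟨ d , k , m ⟩ i j ≡ indicator (onDiagonal? d k m i j)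
⟨⟩-entry d k m i j with k ℤ.≤? idx i | idx i ℤ.≤? m | idx j - idx i ℤ.≟ d
... | yes _ | yes _ | yes _ = refl
... | yes _ | yes _ | no _  = refl
... | yes _ | no _  | _     = refl
... | no _  | _     | _     = refl

⟨⟩-cong : ∀ {d d′ k k′ m m′} → d ≡ d′ → k ≡ k′ → m ≡ m′ →
          ⟨_,_,_⟩ {n} d k m ≈ ⟨ d′ , k′ , m′ ⟩
⟨⟩-cong refl refl refl _ _ = refl

⟨⟩-empty : ∀ {d k m} → m < k → ⟨_,_,_⟩ {n} d k m ≈ zeroMat
⟨⟩-empty {d = d} {k} {m} m<k i j =
  trans (⟨⟩-entry d k m i j)
        (indicator-no (onDiagonal? d k m i j)
          λ on → ℤ.<⇒≱ m<k (ℤ.≤-trans (proj₁ (proj₁ on)) (proj₂ (proj₁ on))))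

identity≈⟨⟩ : identity {n} ≈ ⟨ + 0 , + 1 , + n ⟩
identity≈⟨⟩ {n} i j = trans (indicator-cong (toℕ i ℕ.≟ toℕ j) (onDiagonal? _ _ _ i j) i≡j⇔)
                            (sym (⟨⟩-entry _ _ _ i j))
  where
  i≡j⇔ : toℕ i ≡ toℕ j ⇔ OnDiagonal (+ 0) (+ 1) (+ n) i j
  i≡j⇔ = mk⇔ (λ i≡j → (+≤+ (s≤s z≤n) , +≤+ (Fin.toℕ<n i))
                       , trans (cong (λ t → idx j - + suc t) i≡j) (ℤ.+-inverseʳ (idx j)))
              (λ (_ , j-i≡0) → ℕ.suc-injective (ℤ.+-injective (sym (ℤ.i-j≡0⇒i≡j _ _ j-i≡0))))

OnDiagonal⇒column : ∀ {d k m} {i l : Fin n} → OnDiagonal d k m i l → idx l ≡ idx i + d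
OnDiagonal⇒column {d = d} {i = i} {l} (_ , l-i≡d) =
  trans (split (idx l) (idx i)) (cong (λ t → idx i + t) l-i≡d)
  where
  split : ∀ l i → l ≡ i + (l - i)
  split = solve-∀

OnDiagonal⇒≡ : ∀ {d k m} {i l l₀ : Fin n} → idx l₀ ≡ idx i + d → OnDiagonal d k m i l → l ≡ l₀
OnDiagonal⇒≡ l₀≡i+d on = idx-injective (trans (OnDiagonal⇒column on) (sym l₀≡i+d))

OnDiagonal-∘ : ∀ {d k m d′ k′ m′} {i l j : Fin n} → idx l ≡ idx i + d →
               (OnDiagonal d k m i l × OnDiagonal d′ k′ m′ l j)
               ⇔ OnDiagonal (d + d′) (k ⊔ (k′ - d)) (m ⊓ (m′ - d)) i j
OnDiagonal-∘ {d = d} {k} {m} {d′} {k′} {m′} {i} {l} {j} l≡i+d = mk⇔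
  (λ ((i∈ , _) , (l∈ , j-l≡d′)) →
       Equivalence.from window (i∈ , subst (_∈[ k′ , m′ ]) l≡i+d l∈)
     , Equivalence.to (diff-shift (idx i) (idx j) d d′ l≡i+d) j-l≡d′)
  (λ (i∈ , j-i≡d+d′) →
       (proj₁ (Equivalence.to window i∈) , column⇒diagonal (idx i) d l≡i+d)
     , ( subst (_∈[ k′ , m′ ]) (sym l≡i+d) (proj₂ (Equivalence.to window i∈))
       , Equivalence.from (diff-shift (idx i) (idx j) d d′ l≡i+d) j-i≡d+d′))
  where
  window = ∈-window⇔ (idx i) d k m k′ m′

Valid⇒rows : ∀ {d k m x} → Valid n d k m → x ∈[ k , m ] → x ∈[ + 1 , + n ]
Valid⇒rows {n} {d} (k-lower , _ , m-upper) (k≤x , x≤m) =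
    ℤ.≤-trans (ℤ.i≤i+j (+ 1) (- (+ 0 ⊓ d)) {{ℤ.nonNegative (ℤ.neg-mono-≤ (ℤ.i⊓j≤i (+ 0) d))}})
              (ℤ.≤-trans k-lower k≤x)
  , ℤ.≤-trans x≤m (ℤ.≤-trans m-upper (ℤ.i-j≤i (+ n) (+ 0 ⊔ d) {{ℤ.nonNegative (ℤ.i≤i⊔j (+ 0) d)}}))

Valid⇒columns : ∀ {d k m x} → Valid n d k m → x ∈[ k , m ] → x + d ∈[ + 1 , + n ]
Valid⇒columns {n} {d} {k} {m} {x} (k-lower , _ , m-upper) (k≤x , x≤m) =
    ℤ.≤-trans (Equivalence.to (i-k≤j⇔i≤j+k (+ 1) k (+ 0 ⊓ d)) k-lower)
              (ℤ.+-mono-≤ k≤x (ℤ.i⊓j≤j (+ 0) d))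
  , ℤ.≤-trans (ℤ.+-mono-≤ x≤m (ℤ.i≤j⊔i (+ 0) d))
              (Equivalence.to (i≤j-k⇔i+k≤j m (+ n) (+ 0 ⊔ d)) m-upper)

≈-trans : {A B C : Mat n} → A ≈ B → B ≈ C → A ≈ C
≈-trans A≈B B≈C i j = trans (A≈B i j) (B≈C i j)

⊗-congˡ : (A : Mat n) {B B′ : Mat n} → B ≈ B′ → (A ⊗ B) ≈ (A ⊗ B′)
⊗-congˡ A B≈B′ i j = sumFin-cong (λ l → cong (A i l ℕ.*_) (B≈B′ l j))

⟨⟩-⊗-⟨⟩ : ∀ d k m d′ k′ m′ → Valid n d k m →
          (⟨_,_,_⟩ {n} d k m ⊗ ⟨ d′ , k′ , m′ ⟩) ≈ ⟨ d + d′ , k ⊔ (k′ - d) , m ⊓ (m′ - d) ⟩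
⟨⟩-⊗-⟨⟩ {n} d k m d′ k′ m′ v i j = begin
  sumFin (λ l → ⟨ d , k , m ⟩ i l ℕ.* ⟨ d′ , k′ , m′ ⟩ l j)
    ≡⟨ sumFin-cong (λ l → trans (cong₂ ℕ._*_ (⟨⟩-entry d k m i l) (⟨⟩-entry d′ k′ m′ l j))
                                (indicator-* (onDiagonal? d k m i l) _)) ⟩
  sumFin (indicator ∘ through?)
    ≡⟨ sum-through ⟩
  indicator (onDiagonal? (d + d′) K M i j)
    ≡⟨ ⟨⟩-entry (d + d′) K M i j ⟨
  ⟨ d + d′ , K , M ⟩ i j ∎
  where
  open ≡-Reasoning
  K = k ⊔ (k′ - d)
  M = m ⊓ (m′ - d)
  through? : ∀ l → Dec (OnDiagonal d k m i l × OnDiagonal d′ k′ m′ l j)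
  through? l = onDiagonal? d k m i l ×-dec onDiagonal? d′ k′ m′ l j
  sum-through : sumFin (indicator ∘ through?) ≡ indicator (onDiagonal? (d + d′) K M i j)
  sum-through with idx i + d ∈?[ + 1 , + n ]
  ... | yes i+d∈ =
    trans (sumFin-indicator-at through? (fromIdx _ i+d∈) (OnDiagonal⇒≡ (idx-fromIdx _ i+d∈) ∘ proj₁))
          (indicator-cong _ _ (OnDiagonal-∘ (idx-fromIdx _ i+d∈)))
  ... | no i+d∉ =
    trans (sumFin-zero λ l → indicator-no (through? l) λ t →
            i+d∉ (subst (_∈[ + 1 , + n ]) (OnDiagonal⇒column (proj₁ t)) (idx∈[1,n] l)))
          (sym (indicator-no _ λ on → i+d∉ (Valid⇒columns {d = d} v (proj₁ (window⇒ (proj₁ on))))))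
    where window⇒ = Equivalence.to (∈-window⇔ (idx i) d k m k′ m′)

⟨⟩-⊗-identity : ∀ {d k m} → Valid n d k m → (⟨_,_,_⟩ {n} d k m ⊗ identity) ≈ ⟨ d , k , m ⟩
⟨⟩-⊗-identity {n} {d} {k} {m} v@(_ , k≤m , _) =
  ≈-trans (⊗-congˡ ⟨ d , k , m ⟩ identity≈⟨⟩)
  (≈-trans (⟨⟩-⊗-⟨⟩ d k m (+ 0) (+ 1) (+ n) v)
           (⟨⟩-cong (ℤ.+-identityʳ d)
                    (ℤ.i≥j⇒i⊔j≡i (Equivalence.from (i-k≤j⇔i≤j+k (+ 1) k d) 1≤k+d))
                    (ℤ.i≤j⇒i⊓j≡i (Equivalence.from (i≤j-k⇔i+k≤j m (+ n) d) m+d≤n))))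
  where
  1≤k+d = proj₁ (Valid⇒columns {d = d} v (ℤ.≤-refl , k≤m))
  m+d≤n = proj₂ (Valid⇒columns {d = d} v (k≤m , ℤ.≤-refl))

dPow-suc : ∀ j d → d + dPow (suc j) d ≡ dPow (suc (suc j)) d
dPow-suc j d = lemma d (+ suc j)
  where
  lemma : ∀ d t → d + t * d ≡ (+ 1 + t) * d
  lemma = solve-∀

private
  -*0 : ∀ x t → x - t * + 0 ≡ x
  -*0 = solve-∀

  -0* : ∀ x t → x - + 0 * t ≡ x
  -0* = solve-∀

  -*-step : ∀ x t d → x - t * d - d ≡ x - (+ 1 + t) * d
  -*-step = solve-∀

-- Since + suc j - + 1 computes to + j, kPow (suc j) d k unfolds to k - + j * (+ 0 ⊓ d);
-- for d = + a (resp. -[1+ b ]) the min (resp. max) with + 0 also computes.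
kPow-suc : ∀ j d k → k ⊔ (kPow (suc j) d k - d) ≡ kPow (suc (suc j)) d k
kPow-suc j (+ a) k = begin
  k ⊔ (k - + j * + 0 - + a)  ≡⟨ cong (λ t → k ⊔ (t - + a)) (-*0 k (+ j)) ⟩
  k ⊔ (k - + a)              ≡⟨ ℤ.i≥j⇒i⊔j≡i (ℤ.i-j≤i k (+ a)) ⟩
  k                          ≡⟨ -*0 k (+ suc j) ⟨
  k - + suc j * + 0          ∎
  where open ≡-Reasoning
kPow-suc j -[1+ b ] k = begin
  k ⊔ (k - + j * -[1+ b ] - -[1+ b ])  ≡⟨ cong (k ⊔_) (-*-step k (+ j) -[1+ b ]) ⟩
  k ⊔ (k - + suc j * -[1+ b ])         ≡⟨ ℤ.i≤j⇒i⊔j≡j (ℤ.i≤i+j k _) ⟩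
  k - + suc j * -[1+ b ]               ∎
  where open ≡-Reasoning

mPow-suc : ∀ j d m → m ⊓ (mPow (suc j) d m - d) ≡ mPow (suc (suc j)) d m
mPow-suc j (+ a) m = begin
  m ⊓ (m - + j * + a - + a)  ≡⟨ cong (m ⊓_) (-*-step m (+ j) (+ a)) ⟩
  m ⊓ (m - + suc j * + a)    ≡⟨ ℤ.i≥j⇒i⊓j≡j m-sa≤m ⟩
  m - + suc j * + a          ∎
  where
  open ≡-Reasoning
  m-sa≤m : m - + suc j * + a ≤ m
  m-sa≤m = subst (λ t → m - t ≤ m) (ℤ.pos-* (suc j) a) (ℤ.i-j≤i m (+ (suc j ℕ.* a)))
mPow-suc j -[1+ b ] m = begin
  m ⊓ (m - + j * + 0 - -[1+ b ])  ≡⟨ cong (λ t → m ⊓ (t - -[1+ b ])) (-*0 m (+ j)) ⟩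
  m ⊓ (m - -[1+ b ])              ≡⟨ ℤ.i≤j⇒i⊓j≡i (ℤ.i≤i+j m (+ suc b)) ⟩
  m                               ≡⟨ -*0 m (+ suc j) ⟨
  m - + suc j * + 0               ∎
  where open ≡-Reasoning

⟨⟩-^-suc : ∀ {d k m} → Valid n d k m → ∀ j →
           (⟨_,_,_⟩ {n} d k m ^ suc j) ≈ ⟨ dPow (suc j) d , kPow (suc j) d k , mPow (suc j) d m ⟩
⟨⟩-^-suc {n} {d} {k} {m} v zero =
  ≈-trans (⟨⟩-⊗-identity v)
          (⟨⟩-cong (sym (ℤ.*-identityˡ d)) (sym (-0* k (+ 0 ⊓ d))) (sym (-0* m (+ 0 ⊔ d))))
⟨⟩-^-suc {n} {d} {k} {m} v (suc j) =
  ≈-trans (⊗-congˡ ⟨ d , k , m ⟩ (⟨⟩-^-suc v j))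
  (≈-trans (⟨⟩-⊗-⟨⟩ d k m (dPow (suc j) d) (kPow (suc j) d k) (mPow (suc j) d m) v)
           (⟨⟩-cong (dPow-suc j d) (kPow-suc j d k) (mPow-suc j d m)))

*-distribˡ-0⊓ : ∀ s d → + s * (+ 0 ⊓ d) ≡ + 0 ⊓ (+ s * d)
*-distribˡ-0⊓ s d =
  trans (ℤ.*-distribˡ-⊓-nonNeg (+ s) (+ 0) d) (cong (_⊓ (+ s * d)) (ℤ.*-zeroʳ (+ s)))

*-distribˡ-0⊔ : ∀ s d → + s * (+ 0 ⊔ d) ≡ + 0 ⊔ (+ s * d)
*-distribˡ-0⊔ s d =
  trans (ℤ.*-distribˡ-⊔-nonNeg (+ s) (+ 0) d) (cong (_⊔ (+ s * d)) (ℤ.*-zeroʳ (+ s)))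

Valid-^ : ∀ {d k m} → Valid n d k m → ∀ j → kPow (suc j) d k ≤ mPow (suc j) d m →
          Valid n (dPow (suc j) d) (kPow (suc j) d k) (mPow (suc j) d m)
Valid-^ {n} {d} {k} {m} (k-lower , _ , m-upper) j kᵖ≤mᵖ =
    subst (_≤ kPow (suc j) d k) (shift (+ 1) (+ 0 ⊓ d) (*-distribˡ-0⊓ (suc j) d))
          (ℤ.+-monoˡ-≤ (- (+ j * (+ 0 ⊓ d))) k-lower)
  , kᵖ≤mᵖ
  , subst (mPow (suc j) d m ≤_) (shift (+ n) (+ 0 ⊔ d) (*-distribˡ-0⊔ (suc j) d))
          (ℤ.+-monoˡ-≤ (- (+ j * (+ 0 ⊔ d))) m-upper)
  where
  shift : ∀ x c {c′} → + suc j * c ≡ c′ → x - c - + j * c ≡ x - c′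
  shift x c refl = lemma x c (+ j)
    where
    lemma : ∀ x c t → x - c - t * c ≡ x - (+ 1 + t) * c
    lemma = solve-∀

between? : ∀ a b (i : Fin n) → Dec (a ℕ.≤ toℕ i × toℕ i ℕ.< b)
between? a b i = a ℕ.≤? toℕ i ×-dec toℕ i ℕ.<? b

count-interval : ∀ n a b → b ℕ.≤ n → sumFin {n} (λ i → indicator (between? a b i)) ≡ b ℕ.∸ a
count-interval n a zero _ =
  trans (sumFin-zero {n} λ i → indicator-no (between? a 0 i) λ ()) (sym (ℕ.0∸n≡0 a))
count-interval (suc n) zero (suc b) (s≤s b≤n) =
  cong suc (trans (sumFin-cong {n} λ i →
                     indicator-cong (between? 0 (suc b) (Fin.suc i)) (between? 0 b i)
                       (mk⇔ (λ (_ , i<b) → z≤n , s≤s⁻¹ i<b) (λ (_ , i<b) → z≤n , s≤s i<b)))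
                  (count-interval n zero b b≤n))
count-interval (suc n) (suc a) (suc b) (s≤s b≤n) =
  trans (sumFin-cong {n} λ i →
           indicator-cong (between? (suc a) (suc b) (Fin.suc i)) (between? a b i)
             (mk⇔ (λ (a<i , i<b) → s≤s⁻¹ a<i , s≤s⁻¹ i<b) (λ (a≤i , i<b) → s≤s a≤i , s≤s i<b)))
        (count-interval n a b b≤n)

count-window : ∀ {k m} → + 1 ≤ k → k ≤ m → m ≤ + n →
               + sumFin {n} (λ i → indicator (idx i ∈?[ k , m ])) ≡ m - k + + 1
count-window {n} {+ suc a} {+ b} _ k≤m m≤n = begin
  + sumFin {n} (λ i → indicator (idx i ∈?[ + suc a , + b ]))
    ≡⟨ cong +_ (sumFin-cong {n} λ i →
         indicator-cong (idx i ∈?[ + suc a , + b ]) (between? a b i)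
           (mk⇔ (λ (a<i , i<b) → s≤s⁻¹ (ℤ.drop‿+≤+ a<i) , ℤ.drop‿+≤+ i<b)
                (λ (a≤i , i<b) → +≤+ (s≤s a≤i) , +≤+ i<b))) ⟩
  + sumFin {n} (λ i → indicator (between? a b i))
    ≡⟨ cong +_ (count-interval n a b (ℤ.drop‿+≤+ m≤n)) ⟩
  + (b ℕ.∸ a)
    ≡⟨ ℤ.≤-⊖ (ℕ.<⇒≤ (ℤ.drop‿+≤+ k≤m)) ⟨
  b ℤ.⊖ a
    ≡⟨ ℤ.m-n≡m⊖n b a ⟨
  + b - + a
    ≡⟨ lemma (+ b) (+ a) ⟩
  + b - + suc a + + 1 ∎
  where
  open ≡-Reasoning
  lemma : ∀ b a → b - a ≡ b - (+ 1 + a) + + 1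
  lemma = solve-∀
count-window {k = + zero} (+≤+ ()) _ _
count-window {k = + suc _} {m = -[1+ _ ]} _ () _

rowSum-⟨⟩ : ∀ d k m → Valid n d k m → (i : Fin n) →
            sumFin (λ j → indicator (⟨ d , k , m ⟩ i j ℕ.≟ 1)) ≡ indicator (idx i ∈?[ k , m ])
rowSum-⟨⟩ d k m v i = begin
  sumFin (λ j → indicator (⟨ d , k , m ⟩ i j ℕ.≟ 1))
    ≡⟨ sumFin-cong (λ j → trans (cong (λ e → indicator (e ℕ.≟ 1)) (⟨⟩-entry d k m i j))
                                (indicator-≟1 (onDiagonal? d k m i j))) ⟩
  sumFin (indicator ∘ onDiagonal? d k m i)
    ≡⟨ indicator-by-cases (idx i ∈?[ k , m ]) on-window off-window ⟩
  indicator (idx i ∈?[ k , m ]) ∎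
  where
  open ≡-Reasoning
  on-window : idx i ∈[ k , m ] → sumFin (indicator ∘ onDiagonal? d k m i) ≡ 1
  on-window i∈ =
    trans (sumFin-indicator-at (onDiagonal? d k m i) l₀ (OnDiagonal⇒≡ l₀≡i+d))
          (indicator-yes (onDiagonal? d k m i l₀) (i∈ , column⇒diagonal (idx i) d l₀≡i+d))
    where
    i+d∈ = Valid⇒columns {d = d} v i∈
    l₀ = fromIdx _ i+d∈
    l₀≡i+d = idx-fromIdx _ i+d∈
  off-window : ¬ idx i ∈[ k , m ] → sumFin (indicator ∘ onDiagonal? d k m i) ≡ 0
  off-window i∉ = sumFin-zero λ l → indicator-no (onDiagonal? d k m i l) (i∉ ∘ proj₁)

countOnes-⟨⟩ : ∀ d k m → Valid n d k m → + countOnes (⟨_,_,_⟩ {n} d k m) ≡ m - k + + 1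
countOnes-⟨⟩ d k m v@(_ , k≤m , _) =
  trans (cong +_ (sumFin-cong (rowSum-⟨⟩ d k m v)))
        (count-window (proj₁ (Valid⇒rows {d = d} v (ℤ.≤-refl , k≤m))) k≤m
                      (proj₂ (Valid⇒rows {d = d} v (k≤m , ℤ.≤-refl))))

countOnes-cong : {A B : Mat n} → A ≈ B → countOnes A ≡ countOnes B
countOnes-cong A≈B =
  sumFin-cong λ i → sumFin-cong λ j → cong (λ e → indicator (e ℕ.≟ 1)) (A≈B i j)

∣d∣≡0⊔d-0⊓d : ∀ d → + ∣ d ∣ ≡ + 0 ⊔ d - + 0 ⊓ d
∣d∣≡0⊔d-0⊓d (+ a)    = sym (ℤ.+-identityʳ (+ a))
∣d∣≡0⊔d-0⊓d -[1+ b ] = refl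

mPow-kPow+1 : ∀ j d k m →
              mPow (suc j) d m - kPow (suc j) d k + + 1 ≡ m - k + + 1 - (+ suc j - + 1) * + ∣ d ∣
mPow-kPow+1 j d k m = trans (lemma m k (+ j) (+ 0 ⊔ d) (+ 0 ⊓ d))
                            (cong (λ t → m - k + + 1 - + j * t) (sym (∣d∣≡0⊔d-0⊓d d)))
  where
  lemma : ∀ m k t ν μ → m - t * ν - (k - t * μ) + + 1 ≡ m - k + + 1 - t * (ν - μ)
  lemma = solve-∀

corollary2 : (n : ℕ) → 2 ℕ.≤ n → (d k m : ℤ) → Valid n d k m →
    (j : ℕ) → 1 ℕ.≤ j →
    ((kPow j d k ℤ.≤ mPow j d m →
        Valid n (dPow j d) (kPow j d k) (mPow j d m)
        × (⟨_,_,_⟩ {n} d k m ^ j) ≈ ⟨ dPow j d , kPow j d k , mPow j d m ⟩)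
    × (mPow j d m ℤ.< kPow j d k → (⟨_,_,_⟩ {n} d k m ^ j) ≈ zeroMat)
    × (¬ ((⟨_,_,_⟩ {n} d k m ^ j) ≈ zeroMat) →
        + countOnes (⟨_,_,_⟩ {n} d k m ^ j)
          ≡ m ℤ.- k ℤ.+ + 1 ℤ.- (+ j ℤ.- + 1) ℤ.* + ∣ d ∣))
corollary2 n _ d k m v (suc j) _ = nonempty , empty , count
  where
  xʲ = ⟨_,_,_⟩ {n} d k m ^ suc j
  xʲ≈ : xʲ ≈ ⟨ dPow (suc j) d , kPow (suc j) d k , mPow (suc j) d m ⟩
  xʲ≈ = ⟨⟩-^-suc v j

  nonempty : kPow (suc j) d k ≤ mPow (suc j) d m →
             Valid n (dPow (suc j) d) (kPow (suc j) d k) (mPow (suc j) d m)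
             × xʲ ≈ ⟨ dPow (suc j) d , kPow (suc j) d k , mPow (suc j) d m ⟩
  nonempty kᵖ≤mᵖ = Valid-^ v j kᵖ≤mᵖ , xʲ≈

  empty : mPow (suc j) d m < kPow (suc j) d k → xʲ ≈ zeroMat
  empty mᵖ<kᵖ = ≈-trans xʲ≈ (⟨⟩-empty mᵖ<kᵖ)

  count : ¬ (xʲ ≈ zeroMat) → + countOnes xʲ ≡ m - k + + 1 - (+ suc j - + 1) * + ∣ d ∣
  count xʲ≉0 with kPow (suc j) d k ℤ.≤? mPow (suc j) d m
  ... | no kᵖ≰mᵖ = contradiction (empty (ℤ.≰⇒> kᵖ≰mᵖ)) xʲ≉0
  ... | yes kᵖ≤mᵖ = begin
    + countOnes xʲ
      ≡⟨ cong +_ (countOnes-cong xʲ≈) ⟩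
    + countOnes (⟨_,_,_⟩ {n} (dPow (suc j) d) (kPow (suc j) d k) (mPow (suc j) d m))
      ≡⟨ countOnes-⟨⟩ (dPow (suc j) d) _ _ (Valid-^ v j kᵖ≤mᵖ) ⟩
    mPow (suc j) d m - kPow (suc j) d k + + 1
      ≡⟨ mPow-kPow+1 j d k m ⟩
    m - k + + 1 - (+ suc j - + 1) * + ∣ d ∣ ∎
    where open ≡-Reasoning
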